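{- For every $n$, every $k,\ell\ge 2$, every $c>0$ and every outcome of the random choices $(e_i)_{1\le i\le cn}$, the hypergraph $\hat W_n$ is orientable (in the weighted sense) if and only if the hypergraph $W_n$ is orientable.
   Context: **Random choices.** Let $\mathbb{Z}_n=\{0,\dots,n-1\}$. Choose $e_1,\dots,e_{cn}$ independently; each $e_i$ is a multiset of $k$ elements picked independently and uniformly from $\mathbb{Z}_n$. **Hypergraph $W_n$.** - Vertex set $\mathbb{Z}_n$, edges $e_i'=\bigcup_{j\in e_i}[j,j+\ell)$, with intervals taken cyclically modulo $n$. - $W_n$ is orientable if each edge can be assigned one of its vertices with no vertex assigned to two edges. **Weighted hypergraph $\hat W_n$.** - Vertex set $\mathbb{Z}_n$, every vertex of weight $\eta(v)=\ell$. - Helper edges $c_i=\{i,i+1\}$ for $i\in\mathbb{Z}_n$, each of weight $\ell-1$. - Ordinary edges $e_1,\dots,e_{cn}$, each of weight $1$. **Weighted orientation.** An orientation of a weighted hypergraph $(V,E,\eta)$ assigns to each pair $(e,v)$ with $v\in e$ a number $\mu(e,v)\in\mathbb{N}_0$ such that: - $\sum_{v\in e}\mu(e,v)=\eta(e)$ for every edge $e$; - $\sum_{e\ni v}\mu(e,v)\le\eta(v)$ for every vertex $v$. It is orientable if such a $\mu$ exists. -}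

module Defs where

open import Data.Nat using (ℕ; zero; suc; _+_; _∸_; _≤_; _<_)
open import Data.Nat.DivMod using (_%_)
open import Data.Fin using (Fin; toℕ; _≟_; splitAt) renaming (zero to fzero; suc to fsuc)
open import Data.Fin.Properties using ()
open import Data.Vec using (Vec; lookup)
open import Data.Sum using (_⊎_; inj₁; inj₂)
open import Data.Product using (Σ; ∃; ∃-syntax; _×_; _,_)
open import Relation.Binary.PropositionalEquality using (_≡_)
open import Relation.Nullary using (does)
open import Data.Bool using (if_then_else_)
open import Function.Definitions using (Injective)

sumFin : (n : ℕ) → (Fin n → ℕ) → ℕ
sumFin zero    f = 0
sumFin (suc n) f = f fzero + sumFin n (λ i → f (fsuc i))

-- reduction modulo n (value for n = 0 is irrelevant, Fin 0 is empty)
modn : ℕ → ℕ → ℕ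
modn zero    a = a
modn (suc n) a = a % suc n

record Hypergraph : Set₁ where
  field
    nV  : ℕ
    nE  : ℕ
    _∈E_ : Fin nV → Fin nE → Set

Orientable : Hypergraph → Set
Orientable H = Σ (Fin nE → Fin nV) λ f → ((e : Fin nE) → f e ∈E e) × Injective _≡_ _≡_ f
  where open Hypergraph H

record WHypergraph : Set where
  field
    nV   : ℕ
    nE   : ℕ
    size : Fin nE → ℕ
    vert : (e : Fin nE) → Fin (size e) → Fin nV
    ηV   : Fin nV → ℕ
    ηE   : Fin nE → ℕ

WOrientation : WHypergraph → Set
WOrientation H = (e : Fin nE) → Fin (size e) → ℕ
  where open WHypergraph H

load : (H : WHypergraph) → WOrientation H → Fin (WHypergraph.nV H) → ℕ
load H μ v = sumFin nE λ e → sumFin (size e) λ p →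
               if does (vert e p ≟ v) then μ e p else 0
  where open WHypergraph H

WOrientable : WHypergraph → Set
WOrientable H = Σ (WOrientation H) λ μ →
    ((e : Fin nE) → sumFin (size e) (μ e) ≡ ηE e)
  × ((v : Fin nV) → load H μ v ≤ ηV v)
  where open WHypergraph H

-- The concrete hypergraphs.  An outcome of the random choices is
-- e : Fin m → Vec (Fin n) k  (m = cn edges, each a k-multiset as a k-tuple).

W : (n k ℓ m : ℕ) → (Fin m → Vec (Fin n) k) → Hypergraph
W n k ℓ m e = record
  { nV = n ; nE = m
  ; _∈E_ = λ v i → ∃[ j ] ∃[ t ] (t < ℓ × toℕ v ≡ modn n (toℕ (lookup (e i) j) + t)) }

sucMod : {n : ℕ} → Fin n → Fin n
sucMod {suc n} i = Data.Fin.fromℕ< (Data.Nat.DivMod.m%n<n (suc (toℕ i)) (suc n))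

-- Ŵ_n : n helper edges c_i = {i, i+1} of weight ℓ-1, then m ordinary edges e_i of weight 1;
-- every vertex has weight ℓ
Ŵ : (n k ℓ m : ℕ) → (Fin m → Vec (Fin n) k) → WHypergraph
Ŵ n k ℓ m e = record
  { nV = n ; nE = n + m
  ; size = λ x → sz (splitAt n x)
  ; vert = λ x → vt (splitAt n x)
  ; ηV = λ _ → ℓ
  ; ηE = λ x → we (splitAt n x) }
  where
    sz : Fin n ⊎ Fin m → ℕ
    sz (inj₁ _) = 2
    sz (inj₂ _) = k
    vt : (y : Fin n ⊎ Fin m) → Fin (sz y) → Fin n
    vt (inj₁ i) fzero        = i
    vt (inj₁ i) (fsuc fzero) = sucMod i
    vt (inj₂ i) p            = lookup (e i) p
    we : Fin n ⊎ Fin m → ℕ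
    we (inj₁ _) = ℓ ∸ 1
    we (inj₂ _) = 1

-- An orientation of W assigns to edge i a vertex f i = s i + t i (mod n) with s i ∈ e i and t i < ℓ:
-- item i walks t i steps around the cycle from s i.  Given an injective such f, the helper edge c u
-- sends to u + 1 the number of walks crossing the arc from u to u + 1 (at most ℓ - 1, because those
-- walks end at distinct vertices among u + 1, …, u + ℓ - 1) and the rest of its weight to u, while
-- edge i sends its unit to s i.  Flow conservation along the walks gives every vertex load
-- ℓ - 1 + [w ∈ image f] ≤ ℓ.
--
-- Conversely, let s i be a vertex receiving weight from edge i and Y u the weight c u sends to u + 1.
-- The load bound at u + 1 reads #{i | s i = u + 1} + Y u ≤ 1 + Y (u + 1), so Y bounds the queue of a
-- server at each vertex taking one item per step.  Cutting the cycle after a vertex minimising Y and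
-- serving items first-in-first-out gives an injective assignment in which no item waits more than
-- ℓ - 1 steps.

module Submission where

open import Defs

open import Data.Bool using (if_then_else_)
open import Data.Empty using (⊥; ⊥-elim)
open import Data.Fin as F using (Fin; toℕ; _↑ˡ_; _↑ʳ_; fromℕ<; inject₁; fromℕ; splitAt)
  renaming (zero to fzero; suc to fsuc)
import Data.Fin.Properties as FP
open import Data.Nat
open import Data.Nat.Properties
open import Data.Nat.DivMod
  using (_%_; _/_; _mod_; m%n<n; m<n⇒m%n≡m; [m+n]%n≡m%n; [m+kn]%n≡m%n; m≡m%n+[m/n]*n)
open import Data.Product using (∃-syntax; ∃₂; _×_; _,_; proj₁; proj₂)
open import Data.Sum using (_⊎_; inj₁; inj₂)
open import Data.Vec using (Vec; lookup)
open import Data.List using (allFin)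
open import Data.List.Extrema.Nat using (argmin; f[argmin]≤f[xs])
import Data.List.Relation.Unary.All as All
open import Data.List.Membership.Propositional.Properties using (∈-allFin)
open import Function.Base using (_∘_)
open import Function.Bundles using (_⇔_; mk⇔)
open import Function.Definitions using (Injective)
open import Relation.Binary.PropositionalEquality
open import Relation.Nullary using (Dec; yes; no; does; ¬_)
open import Relation.Nullary.Decidable using (_×-dec_)
open import Relation.Binary.Definitions using (tri<; tri≈; tri>)

open import Algebra.Properties.CommutativeSemigroup +-commutativeSemigroup
  using (xy∙z≈xz∙y; xy∙z≈y∙xz; xy∙z≈x∙zy; x∙yz≈y∙xz; x∙yz≈xz∙y)
open import Algebra.Properties.Semiring.Sum +-*-semiring
  using (sum; sum-syntax; sum-cong-≗; ∑-distrib-+; ∑-comm; *-distribˡ-sum; sum-init-last; sum-replicate-zero)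

χ : ∀ {p} {P : Set p} → Dec P → ℕ
χ d = if does d then 1 else 0

χ-true : ∀ {p} {P : Set p} (d : Dec P) → P → χ d ≡ 1
χ-true (yes _) _ = refl
χ-true (no ¬p) p = ⊥-elim (¬p p)

χ-false : ∀ {p} {P : Set p} (d : Dec P) → ¬ P → χ d ≡ 0
χ-false (yes p) ¬p = ⊥-elim (¬p p)
χ-false (no _) _ = refl

χ-mono : ∀ {p q} {P : Set p} {Q : Set q} (d : Dec P) (d′ : Dec Q) → (P → Q) → χ d ≤ χ d′
χ-mono (yes p) (yes _) _ = ≤-refl
χ-mono (yes p) (no ¬q) f = ⊥-elim (¬q (f p))
χ-mono (no _) _ _ = z≤n

χ-cong : ∀ {p q} {P : Set p} {Q : Set q} (d : Dec P) (d′ : Dec Q) → (P → Q) → (Q → P) → χ d ≡ χ d′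
χ-cong d d′ f g = ≤-antisym (χ-mono d d′ f) (χ-mono d′ d g)

if-does≡χ* : ∀ {p} {P : Set p} (d : Dec P) x → (if does d then x else 0) ≡ χ d * x
if-does≡χ* (yes _) x = sym (+-identityʳ x)
if-does≡χ* (no _) x = refl

χ*-true : ∀ {p} {P : Set p} (d : Dec P) {x} → P → χ d * x ≡ x
χ*-true d {x} p = trans (cong (_* x) (χ-true d p)) (*-identityˡ x)

χ≤χ* : ∀ {p} {P : Set p} (d : Dec P) {x} → 0 < x → χ d ≤ χ d * x
χ≤χ* (yes _) 0<x = ≤-trans 0<x (m≤m+n _ 0)
χ≤χ* (no _) _ = z≤n

χ≤ : ∀ {p} {P : Set p} (d : Dec P) {x} → (P → 1 ≤ x) → χ d ≤ x
χ≤ (yes p) 1≤x = 1≤x p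
χ≤ (no _) _ = z≤n

χ*-elim : ∀ {p r} {P : Set p} (R : ℕ → Set r) (d : Dec P) {x} → (P → R x) → R 0 → R (χ d * x)
χ*-elim R (yes p) {x} Rx _ = subst R (sym (+-identityʳ x)) (Rx p)
χ*-elim R (no _) _ R0 = R0

sumFin≡sum : ∀ n (f : Fin n → ℕ) → sumFin n f ≡ sum f
sumFin≡sum zero f = refl
sumFin≡sum (suc n) f = cong (f fzero +_) (sumFin≡sum n (f ∘ fsuc))

sum-mono-≤ : ∀ {n} {f g : Fin n → ℕ} → (∀ i → f i ≤ g i) → sum f ≤ sum g
sum-mono-≤ {zero} le = z≤n
sum-mono-≤ {suc n} le = +-mono-≤ (le fzero) (sum-mono-≤ (le ∘ fsuc))

sum-mono-< : ∀ {n} {f g : Fin n → ℕ} → (∀ i → f i ≤ g i) → ∀ i → f i < g i → sum f < sum g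
sum-mono-< {suc n} le fzero lt = +-mono-<-≤ lt (sum-mono-≤ (le ∘ fsuc))
sum-mono-< {suc n} le (fsuc i) lt = +-mono-≤-< (le fzero) (sum-mono-< (le ∘ fsuc) i lt)

sum-↑ : ∀ a b (f : Fin (a + b) → ℕ) → sum f ≡ sum (f ∘ (_↑ˡ b)) + sum (f ∘ (a ↑ʳ_))
sum-↑ zero b f = refl
sum-↑ (suc a) b f = trans (cong (f fzero +_) (sum-↑ a b (f ∘ fsuc))) (sym (+-assoc (f fzero) _ _))

term≤sum : ∀ {n} (f : Fin n → ℕ) i → f i ≤ sum f
term≤sum f fzero = m≤m+n _ _
term≤sum f (fsuc i) = ≤-trans (term≤sum (f ∘ fsuc) i) (m≤n+m _ _)

two-terms≤sum : ∀ {n} (f : Fin n → ℕ) {i j} → i ≢ j → f i + f j ≤ sum f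
two-terms≤sum f {fzero} {fzero} i≢j = ⊥-elim (i≢j refl)
two-terms≤sum f {fzero} {fsuc j} _ = +-monoʳ-≤ (f fzero) (term≤sum (f ∘ fsuc) j)
two-terms≤sum f {fsuc i} {fzero} _ =
  subst (_≤ sum f) (+-comm (f fzero) _) (+-monoʳ-≤ (f fzero) (term≤sum (f ∘ fsuc) i))
two-terms≤sum f {fsuc i} {fsuc j} i≢j =
  ≤-trans (two-terms≤sum (f ∘ fsuc) (i≢j ∘ cong fsuc)) (m≤n+m _ _)

sum-positive⇒term-positive : ∀ {n} (f : Fin n → ℕ) → 0 < sum f → ∃[ i ] 0 < f i
sum-positive⇒term-positive {suc n} f 0<Σ with f fzero in eq
... | suc _ = fzero , subst (0 <_) (sym eq) z<s
... | zero = let i , 0<fi = sum-positive⇒term-positive (f ∘ fsuc) 0<Σ in fsuc i , 0<fi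

sum-select : ∀ {n} (i : Fin n) (f : Fin n → ℕ) → ∑[ j < n ] (χ (j F.≟ i) * f j) ≡ f i
sum-select {suc n} fzero f = begin
  1 * f fzero + ∑[ j < n ] (0 * f (fsuc j)) ≡⟨ cong (_+ _) (*-identityˡ (f fzero)) ⟩
  f fzero + sum {n} (λ _ → 0)               ≡⟨ cong (f fzero +_) (sum-replicate-zero n) ⟩
  f fzero + 0                               ≡⟨ +-identityʳ (f fzero) ⟩
  f fzero                                   ∎
  where open ≡-Reasoning
sum-select {suc n} (fsuc i) f = sum-select i (f ∘ fsuc)

injective⇒count≤1 : ∀ {m n} (f : Fin m → Fin n) → Injective _≡_ _≡_ f →
                    ∀ x → ∑[ i < m ] χ (f i F.≟ x) ≤ 1
injective⇒count≤1 {zero} f inj x = z≤n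
injective⇒count≤1 {suc m} f inj x with f fzero F.≟ x
... | yes f0≡x = ≤-reflexive (cong suc (trans (sum-cong-≗ others-miss) (sum-replicate-zero m)))
  where
  others-miss : ∀ i → χ (f (fsuc i) F.≟ x) ≡ 0
  others-miss i = χ-false (f (fsuc i) F.≟ x) λ fi≡x → FP.0≢1+n (inj (trans f0≡x (sym fi≡x)))
... | no _ = injective⇒count≤1 (f ∘ fsuc) (FP.suc-injective ∘ inj) x

sumUpTo : ℕ → (ℕ → ℕ) → ℕ
sumUpTo t h = ∑[ q < t ] h (toℕ q)

sumUpTo-suc-last : ∀ t h → sumUpTo (suc t) h ≡ sumUpTo t h + h t
sumUpTo-suc-last t h = begin
  sumUpTo (suc t) h
    ≡⟨ sum-init-last (h ∘ toℕ) ⟩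
  ∑[ q < t ] h (toℕ (inject₁ q)) + h (toℕ (fromℕ t))
    ≡⟨ cong₂ _+_ (sum-cong-≗ {t} (cong h ∘ FP.toℕ-inject₁)) (cong h (FP.toℕ-fromℕ t)) ⟩
  sumUpTo t h + h t ∎
  where open ≡-Reasoning

sumUpTo-monoˡ-≤ : ∀ {t t′} h → t ≤ t′ → sumUpTo t h ≤ sumUpTo t′ h
sumUpTo-monoˡ-≤ h z≤n = z≤n
sumUpTo-monoˡ-≤ h (s≤s t≤t′) = +-monoʳ-≤ (h 0) (sumUpTo-monoˡ-≤ (h ∘ suc) t≤t′)

term≤sumUpTo : ∀ {t r} h → r < t → h r ≤ sumUpTo t h
term≤sumUpTo {t} {r} h r<t =
  subst (λ q → h q ≤ sumUpTo t h) (FP.toℕ-fromℕ< r<t) (term≤sum (h ∘ toℕ) (fromℕ< r<t))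

sumUpTo≤ : ∀ t h → (∀ r → h r ≤ 1) → sumUpTo t h ≤ t
sumUpTo≤ zero h h≤1 = z≤n
sumUpTo≤ (suc t) h h≤1 = +-mono-≤ (h≤1 0) (sumUpTo≤ t (h ∘ suc) (h≤1 ∘ suc))

max : ∀ {n} → (Fin n → ℕ) → ℕ
max {zero} f = 0
max {suc n} f = f fzero ⊔ max (f ∘ fsuc)

term≤max : ∀ {n} (f : Fin n → ℕ) i → f i ≤ max f
term≤max f fzero = m≤m⊔n _ _
term≤max f (fsuc i) = ≤-trans (term≤max (f ∘ fsuc) i) (m≤n⊔m _ _)

max≤ : ∀ {n} (f : Fin n → ℕ) {b} → (∀ i → f i ≤ b) → max f ≤ b
max≤ {zero} f f≤b = z≤n
max≤ {suc n} f f≤b = ⊔-lub (f≤b fzero) (max≤ (f ∘ fsuc) (f≤b ∘ fsuc))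

max< : ∀ {n} (f : Fin n → ℕ) {b} → 0 < b → (∀ i → f i < b) → max f < b
max< {zero} f 0<b f<b = 0<b
max< {suc n} f 0<b f<b = ⊔-lub (f<b fzero) (max< (f ∘ fsuc) 0<b (f<b ∘ fsuc))

module ŴLoad (n k ℓ m : ℕ) (e : Fin m → Vec (Fin n) k) where
  open WHypergraph (Ŵ n k ℓ m e)

  share : WOrientation (Ŵ n k ℓ m e) → Fin n → Fin (n + m) → ℕ
  share μ w x = ∑[ p < size x ] (χ (vert x p F.≟ w) * μ x p)

  load-Ŵ : ∀ μ w → load (Ŵ n k ℓ m e) μ w ≡ ∑[ u < n ] share μ w (u ↑ˡ m) + ∑[ i < m ] share μ w (n ↑ʳ i)
  load-Ŵ μ w = begin
    load (Ŵ n k ℓ m e) μ w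
      ≡⟨ sumFin≡sum (n + m) _ ⟩
    ∑[ x < n + m ] sumFin (size x) (λ p → if does (vert x p F.≟ w) then μ x p else 0)
      ≡⟨ sum-cong-≗ {n + m} share≡ ⟩
    ∑[ x < n + m ] share μ w x
      ≡⟨ sum-↑ n m (share μ w) ⟩
    ∑[ u < n ] share μ w (u ↑ˡ m) + ∑[ i < m ] share μ w (n ↑ʳ i) ∎
    where
    open ≡-Reasoning
    share≡ : ∀ x → sumFin (size x) (λ p → if does (vert x p F.≟ w) then μ x p else 0) ≡ share μ w x
    share≡ x = trans (sumFin≡sum (size x) _) (sum-cong-≗ {size x} λ p → if-does≡χ* (vert x p F.≟ w) _)

  assemble : (Fin n → Fin 2 → ℕ) → ((i : Fin m) → Fin k → ℕ) → WOrientation (Ŵ n k ℓ m e)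
  assemble h o x with splitAt n x
  ... | inj₁ u = h u
  ... | inj₂ i = o i

  assemble-weights : ∀ h o → (∀ u → h u fzero + h u (fsuc fzero) ≡ ℓ ∸ 1) → (∀ i → sum (o i) ≡ 1) →
                     ∀ x → sumFin (size x) (assemble h o x) ≡ ηE x
  assemble-weights h o h-wt o-wt x with splitAt n x
  ... | inj₁ u = trans (cong (h u fzero +_) (+-identityʳ _)) (h-wt u)
  ... | inj₂ i = trans (sumFin≡sum k (o i)) (o-wt i)

  share-assemble-helper : ∀ h o u w →
    share (assemble h o) w (u ↑ˡ m) ≡ χ (u F.≟ w) * h u fzero + χ (sucMod u F.≟ w) * h u (fsuc fzero)
  share-assemble-helper h o u w rewrite FP.splitAt-↑ˡ n u m = cong (χ (u F.≟ w) * h u fzero +_) (+-identityʳ _)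

  share-assemble-ordinary : ∀ h o i w →
    share (assemble h o) w (n ↑ʳ i) ≡ ∑[ p < k ] (χ (lookup (e i) p F.≟ w) * o i p)
  share-assemble-ordinary h o i w rewrite FP.splitAt-↑ʳ n m i = refl

  -- The helpers `go` generalise over x so that `with` can abstract `splitAt n x`,
  -- on which the slot type of μ x depends.
  module _ (μ : WOrientation (Ŵ n k ℓ m e)) (μ-wt : ∀ x → sumFin (size x) (μ x) ≡ ηE x) where

    HelperSplit : Fin n → Fin (n + m) → Set
    HelperSplit u x = ∃₂ λ a b → a + b ≡ ℓ ∸ 1 × (∀ w → share μ w x ≡ χ (u F.≟ w) * a + χ (sucMod u F.≟ w) * b)

    helper-share : ∀ u → HelperSplit u (u ↑ˡ m)
    helper-share u = go (u ↑ˡ m) (FP.splitAt-↑ˡ n u m)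
      where
      go : ∀ x → splitAt n x ≡ inj₁ u → HelperSplit u x
      go x eq with splitAt n x | eq | μ x | μ-wt x
      ... | _ | refl | μx | wt =
        μx fzero , μx (fsuc fzero) , trans (cong (μx fzero +_) (sym (+-identityʳ _))) wt ,
        λ w → cong (χ (u F.≟ w) * μx fzero +_) (+-identityʳ _)

    ordinary-share : ∀ i → ∃[ p ] (∀ w → χ (lookup (e i) p F.≟ w) ≤ share μ w (n ↑ʳ i))
    ordinary-share i = go (n ↑ʳ i) (FP.splitAt-↑ʳ n m i)
      where
      go : ∀ x → splitAt n x ≡ inj₂ i → ∃[ p ] (∀ w → χ (lookup (e i) p F.≟ w) ≤ share μ w x)
      go x eq with splitAt n x | eq | μ x | μ-wt x
      ... | _ | refl | μx | wt =
        let p , 0<μp = sum-positive⇒term-positive μx (≤-reflexive (trans (sym wt) (sumFin≡sum k μx))) in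
        p , λ w → ≤-trans (χ≤χ* (lookup (e i) p F.≟ w) 0<μp)
                          (term≤sum (λ p′ → χ (lookup (e i) p′ F.≟ w) * μx p′) p)

module _ {N : ℕ} .{{_ : NonZero N}} where

  toℕ-mod : ∀ a → toℕ (a mod N) ≡ a % N
  toℕ-mod a = FP.toℕ-fromℕ< (m%n<n a N)

  toℕ-mod-id : ∀ (v : Fin N) → toℕ v mod N ≡ v
  toℕ-mod-id v = FP.toℕ-injective (trans (toℕ-mod (toℕ v)) (m<n⇒m%n≡m (FP.toℕ<n v)))

  %-absorbˡ : ∀ a b → (a % N + b) % N ≡ (a + b) % N
  %-absorbˡ a b = begin
    (a % N + b) % N                 ≡⟨ [m+kn]%n≡m%n (a % N + b) (a / N) N ⟨
    (a % N + b + a / N * N) % N     ≡⟨ cong (_% N) (xy∙z≈xz∙y (a % N) b (a / N * N)) ⟩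
    (a % N + a / N * N + b) % N     ≡⟨ cong (λ x → (x + b) % N) (m≡m%n+[m/n]*n a N) ⟨
    (a + b) % N                     ∎
    where open ≡-Reasoning

  mod-absorbˡ : ∀ a b → (toℕ (a mod N) + b) mod N ≡ (a + b) mod N
  mod-absorbˡ a b = FP.toℕ-injective (begin
    toℕ ((toℕ (a mod N) + b) mod N) ≡⟨ toℕ-mod _ ⟩
    (toℕ (a mod N) + b) % N         ≡⟨ cong (λ x → (x + b) % N) (toℕ-mod a) ⟩
    (a % N + b) % N                 ≡⟨ %-absorbˡ a b ⟩
    (a + b) % N                     ≡⟨ toℕ-mod (a + b) ⟨
    toℕ ((a + b) mod N)             ∎)
    where open ≡-Reasoning

  mod-cong : ∀ {a b} → a % N ≡ b % N → a mod N ≡ b mod N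
  mod-cong {a} {b} eq = FP.toℕ-injective (trans (toℕ-mod a) (trans eq (sym (toℕ-mod b))))

  %-absorbʳ : ∀ a b → (a + b % N) % N ≡ (a + b) % N
  %-absorbʳ a b = trans (cong (_% N) (+-comm a (b % N))) (trans (%-absorbˡ b a) (cong (_% N) (+-comm b a)))

  rotate : ℕ → ℕ → Fin N
  rotate c p = (c + p) mod N

  unrotate : ℕ → Fin N → ℕ
  unrotate c v = (toℕ v + (N ∸ c)) % N

  unrotate-rotate : ∀ {c p} → c ≤ N → p < N → unrotate c (rotate c p) ≡ p
  unrotate-rotate {c} {p} c≤N p<N = begin
    (toℕ ((c + p) mod N) + (N ∸ c)) % N ≡⟨ cong (λ x → (x + (N ∸ c)) % N) (toℕ-mod (c + p)) ⟩
    ((c + p) % N + (N ∸ c)) % N         ≡⟨ %-absorbˡ (c + p) (N ∸ c) ⟩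
    (c + p + (N ∸ c)) % N               ≡⟨ cong (_% N) (xy∙z≈y∙xz c p (N ∸ c)) ⟩
    (p + (c + (N ∸ c))) % N             ≡⟨ cong (λ x → (p + x) % N) (m+[n∸m]≡n c≤N) ⟩
    (p + N) % N                         ≡⟨ [m+n]%n≡m%n p N ⟩
    p % N                               ≡⟨ m<n⇒m%n≡m p<N ⟩
    p                                   ∎
    where open ≡-Reasoning

  rotate-unrotate : ∀ {c} → c ≤ N → ∀ v → rotate c (unrotate c v) ≡ v
  rotate-unrotate {c} c≤N v = trans (mod-cong (begin
    (c + (toℕ v + (N ∸ c)) % N) % N     ≡⟨ %-absorbʳ c (toℕ v + (N ∸ c)) ⟩
    (c + (toℕ v + (N ∸ c))) % N         ≡⟨ cong (_% N) (x∙yz≈y∙xz c (toℕ v) (N ∸ c)) ⟩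
    (toℕ v + (c + (N ∸ c))) % N         ≡⟨ cong (λ x → (toℕ v + x) % N) (m+[n∸m]≡n c≤N) ⟩
    (toℕ v + N) % N                     ≡⟨ [m+n]%n≡m%n (toℕ v) N ⟩
    toℕ v % N                           ∎)) (toℕ-mod-id v)
    where open ≡-Reasoning

  -- A visit to u at step q is charged to the walk's end point being u + (t - q).
  crossings≤arrivals : ∀ s t (u : Fin N) →
    sumUpTo t (λ q → χ ((s + q) mod N F.≟ u)) ≤ sumUpTo t (λ r → χ ((s + t) mod N F.≟ (toℕ u + suc r) mod N))
  crossings≤arrivals s zero u = z≤n
  crossings≤arrivals s (suc t) u = begin
    χ ((s + 0) mod N F.≟ u) + sumUpTo t (λ q → χ ((s + suc q) mod N F.≟ u))
      ≡⟨ cong (χ ((s + 0) mod N F.≟ u) +_) (sum-cong-≗ {t} λ q → cong (λ x → χ (x mod N F.≟ u)) (+-suc s (toℕ q))) ⟩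
    χ ((s + 0) mod N F.≟ u) + sumUpTo t (λ q → χ ((suc s + q) mod N F.≟ u))
      ≤⟨ +-monoʳ-≤ _ (crossings≤arrivals (suc s) t u) ⟩
    χ ((s + 0) mod N F.≟ u) + sumUpTo t (λ r → χ ((suc s + t) mod N F.≟ (toℕ u + suc r) mod N))
      ≡⟨ cong (λ x → χ ((s + 0) mod N F.≟ u) + sumUpTo t (λ r → χ (x mod N F.≟ (toℕ u + suc r) mod N))) (+-suc s t) ⟨
    χ ((s + 0) mod N F.≟ u) + sumUpTo t (λ r → χ (end F.≟ (toℕ u + suc r) mod N))
      ≤⟨ +-monoˡ-≤ _ (χ-mono ((s + 0) mod N F.≟ u) (end F.≟ (toℕ u + suc t) mod N) last-arrival) ⟩
    χ (end F.≟ (toℕ u + suc t) mod N) + sumUpTo t (λ r → χ (end F.≟ (toℕ u + suc r) mod N))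
      ≡⟨ +-comm (χ (end F.≟ (toℕ u + suc t) mod N)) _ ⟩
    sumUpTo t (λ r → χ (end F.≟ (toℕ u + suc r) mod N)) + χ (end F.≟ (toℕ u + suc t) mod N)
      ≡⟨ sumUpTo-suc-last t (λ r → χ (end F.≟ (toℕ u + suc r) mod N)) ⟨
    sumUpTo (suc t) (λ r → χ (end F.≟ (toℕ u + suc r) mod N)) ∎
    where
    open ≤-Reasoning
    end = (s + suc t) mod N
    last-arrival : (s + 0) mod N ≡ u → end ≡ (toℕ u + suc t) mod N
    last-arrival refl =
      sym (trans (mod-absorbˡ (s + 0) (suc t)) (cong (λ x → (x + suc t) mod N) (+-identityʳ s)))

sucMod-mod : ∀ {n} a → sucMod (a mod suc n) ≡ suc a mod suc n
sucMod-mod {n} a = begin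
  suc (toℕ (a mod suc n)) mod suc n ≡⟨ cong (_mod suc n) (+-comm 1 _) ⟩
  (toℕ (a mod suc n) + 1) mod suc n ≡⟨ mod-absorbˡ a 1 ⟩
  (a + 1) mod suc n                 ≡⟨ cong (_mod suc n) (+-comm a 1) ⟩
  suc a mod suc n                   ∎
  where open ≡-Reasoning

module W⇒Ŵ (n k ℓ m : ℕ) (e : Fin m → Vec (Fin (suc n)) k) (ℓ≥1 : 1 ≤ ℓ)
  (orientation : Orientable (W (suc n) k ℓ m e)) where

  private
    N : ℕ
    N = suc n

  open ŴLoad N k ℓ m e
  open WHypergraph (Ŵ N k ℓ m e) using (size; ηE)

  f : Fin m → Fin N
  f = proj₁ orientation

  f∈ : ∀ i → ∃[ j ] ∃[ t ] (t < ℓ × toℕ (f i) ≡ (toℕ (lookup (e i) j) + t) % N)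
  f∈ = proj₁ (proj₂ orientation)

  f-injective : Injective _≡_ _≡_ f
  f-injective = proj₂ (proj₂ orientation)

  slot : Fin m → Fin k
  slot i = proj₁ (f∈ i)

  steps : Fin m → ℕ
  steps i = proj₁ (proj₂ (f∈ i))

  steps≤ : ∀ i → steps i ≤ ℓ ∸ 1
  steps≤ i = ∸-monoˡ-≤ 1 (proj₁ (proj₂ (proj₂ (f∈ i))))

  source : Fin m → ℕ
  source i = toℕ (lookup (e i) (slot i))

  path : Fin m → ℕ → Fin N
  path i q = (source i + q) mod N

  path-zero : ∀ i → path i 0 ≡ lookup (e i) (slot i)
  path-zero i = trans (cong (_mod N) (+-identityʳ (source i))) (toℕ-mod-id (lookup (e i) (slot i)))

  path-end : ∀ i → path i (steps i) ≡ f i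
  path-end i = FP.toℕ-injective (trans (toℕ-mod (source i + steps i)) (sym (proj₂ (proj₂ (proj₂ (f∈ i))))))

  crossings : Fin N → ℕ
  crossings u = ∑[ i < m ] sumUpTo (steps i) (λ q → χ (path i q F.≟ u))

  crossings≤ : ∀ u → crossings u ≤ ℓ ∸ 1
  crossings≤ u = begin
    crossings u
      ≤⟨ sum-mono-≤ (λ i → crossings≤arrivals (source i) (steps i) u) ⟩
    ∑[ i < m ] sumUpTo (steps i) (λ r → χ (path i (steps i) F.≟ v r))
      ≡⟨ sum-cong-≗ {m} (λ i → sum-cong-≗ {steps i} λ r → cong (λ x → χ (x F.≟ v (toℕ r))) (path-end i)) ⟩
    ∑[ i < m ] sumUpTo (steps i) (ends-at i)
      ≤⟨ sum-mono-≤ (λ i → sumUpTo-monoˡ-≤ (ends-at i) (steps≤ i)) ⟩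
    ∑[ i < m ] sumUpTo (ℓ ∸ 1) (ends-at i)
      ≡⟨ ∑-comm {m} {ℓ ∸ 1} (λ i r → ends-at i (toℕ r)) ⟩
    sumUpTo (ℓ ∸ 1) (λ r → ∑[ i < m ] ends-at i r)
      ≤⟨ sumUpTo≤ (ℓ ∸ 1) _ (λ r → injective⇒count≤1 f f-injective (v r)) ⟩
    ℓ ∸ 1 ∎
    where
    open ≤-Reasoning
    v : ℕ → Fin N
    v r = (toℕ u + suc r) mod N
    ends-at : Fin m → ℕ → ℕ
    ends-at i r = χ (f i F.≟ v r)

  inflow : Fin N → ℕ
  inflow w = ∑[ u < N ] (χ (sucMod u F.≟ w) * crossings u)

  inflow≡ : ∀ w → inflow w ≡ ∑[ i < m ] sumUpTo (steps i) (λ q → χ (path i (suc q) F.≟ w))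
  inflow≡ w = begin
    inflow w
      ≡⟨ sum-cong-≗ {N} distribute ⟩
    ∑[ u < N ] ∑[ i < m ] sumUpTo (steps i) (step u i)
      ≡⟨ ∑-comm {N} {m} (λ u i → sumUpTo (steps i) (step u i)) ⟩
    ∑[ i < m ] ∑[ u < N ] sumUpTo (steps i) (step u i)
      ≡⟨ sum-cong-≗ {m} (λ i → ∑-comm {N} {steps i} (λ u q → step u i (toℕ q))) ⟩
    ∑[ i < m ] sumUpTo (steps i) (λ q → ∑[ u < N ] step u i q)
      ≡⟨ sum-cong-≗ {m} (λ i → sum-cong-≗ {steps i} λ q → step-from (path i (toℕ q))) ⟩
    ∑[ i < m ] sumUpTo (steps i) (λ q → χ (sucMod (path i q) F.≟ w))
      ≡⟨ sum-cong-≗ {m} (λ i → sum-cong-≗ {steps i} λ q → cong (λ x → χ (x F.≟ w)) (next-on-path i (toℕ q))) ⟩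
    ∑[ i < m ] sumUpTo (steps i) (λ q → χ (path i (suc q) F.≟ w)) ∎
    where
    open ≡-Reasoning
    into-w : Fin N → ℕ
    into-w u = χ (sucMod u F.≟ w)
    step : Fin N → Fin m → ℕ → ℕ
    step u i q = into-w u * χ (path i q F.≟ u)
    distribute : ∀ u → into-w u * crossings u ≡ ∑[ i < m ] sumUpTo (steps i) (step u i)
    distribute u = trans (*-distribˡ-sum {m} (into-w u) (λ i → sumUpTo (steps i) (λ q → χ (path i q F.≟ u))))
                         (sum-cong-≗ {m} λ i → *-distribˡ-sum {steps i} (into-w u) (λ q → χ (path i (toℕ q) F.≟ u)))
    step-from : ∀ x → ∑[ u < N ] (into-w u * χ (x F.≟ u)) ≡ into-w x
    step-from x = trans (sum-cong-≗ {N} λ u → trans (*-comm (into-w u) (χ (x F.≟ u)))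
                                                (cong (_* into-w u) (χ-cong (x F.≟ u) (u F.≟ x) sym sym)))
                        (sum-select x into-w)
    next-on-path : ∀ i q → sucMod (path i q) ≡ path i (suc q)
    next-on-path i q = trans (sucMod-mod (source i + q)) (cong (_mod N) (sym (+-suc (source i) q)))

  conservation : ∀ w → inflow w + ∑[ i < m ] χ (lookup (e i) (slot i) F.≟ w)
                     ≡ crossings w + ∑[ i < m ] χ (f i F.≟ w)
  conservation w = begin
    inflow w + ∑[ i < m ] χ (lookup (e i) (slot i) F.≟ w)
      ≡⟨ cong₂ _+_ (inflow≡ w) (sum-cong-≗ {m} λ i → cong (λ x → χ (x F.≟ w)) (sym (path-zero i))) ⟩
    ∑[ i < m ] sumUpTo (steps i) (visits i ∘ suc) + ∑[ i < m ] visits i 0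
      ≡⟨ ∑-distrib-+ {m} (λ i → sumUpTo (steps i) (visits i ∘ suc)) (λ i → visits i 0) ⟨
    ∑[ i < m ] (sumUpTo (steps i) (visits i ∘ suc) + visits i 0)
      ≡⟨ sum-cong-≗ {m} (λ i → trans (+-comm (sumUpTo (steps i) (visits i ∘ suc)) _)
                                     (sumUpTo-suc-last (steps i) (visits i))) ⟩
    ∑[ i < m ] (sumUpTo (steps i) (visits i) + visits i (steps i))
      ≡⟨ ∑-distrib-+ {m} (λ i → sumUpTo (steps i) (visits i)) (λ i → visits i (steps i)) ⟩
    crossings w + ∑[ i < m ] visits i (steps i)
      ≡⟨ cong (crossings w +_) (sum-cong-≗ {m} λ i → cong (λ x → χ (x F.≟ w)) (path-end i)) ⟩
    crossings w + ∑[ i < m ] χ (f i F.≟ w) ∎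
    where
    open ≡-Reasoning
    visits : Fin m → ℕ → ℕ
    visits i q = χ (path i q F.≟ w)

  helper-split : Fin N → Fin 2 → ℕ
  helper-split u fzero = ℓ ∸ 1 ∸ crossings u
  helper-split u (fsuc _) = crossings u

  ordinary-split : (i : Fin m) → Fin k → ℕ
  ordinary-split i p = χ (p F.≟ slot i)

  μ : WOrientation (Ŵ N k ℓ m e)
  μ = assemble helper-split ordinary-split

  μ-weights : ∀ x → sumFin (size x) (μ x) ≡ ηE x
  μ-weights = assemble-weights helper-split ordinary-split
    (λ u → m∸n+n≡m (crossings≤ u))
    (λ i → trans (sum-cong-≗ {k} λ p → sym (*-identityʳ _)) (sum-select (slot i) (λ _ → 1)))

  μ-load : ∀ w → load (Ŵ N k ℓ m e) μ w ≤ ℓ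
  μ-load w = begin
    load (Ŵ N k ℓ m e) μ w
      ≡⟨ load-Ŵ μ w ⟩
    ∑[ u < N ] share μ w (u ↑ˡ m) + ∑[ i < m ] share μ w (N ↑ʳ i)
      ≡⟨ cong₂ _+_ helpers ordinaries ⟩
    ℓ ∸ 1 ∸ crossings w + inflow w + sources
      ≡⟨ +-assoc (ℓ ∸ 1 ∸ crossings w) _ _ ⟩
    ℓ ∸ 1 ∸ crossings w + (inflow w + sources)
      ≡⟨ cong (ℓ ∸ 1 ∸ crossings w +_) (conservation w) ⟩
    ℓ ∸ 1 ∸ crossings w + (crossings w + ∑[ i < m ] χ (f i F.≟ w))
      ≡⟨ +-assoc (ℓ ∸ 1 ∸ crossings w) _ _ ⟨
    ℓ ∸ 1 ∸ crossings w + crossings w + ∑[ i < m ] χ (f i F.≟ w)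
      ≡⟨ cong (_+ ∑[ i < m ] χ (f i F.≟ w)) (m∸n+n≡m (crossings≤ w)) ⟩
    ℓ ∸ 1 + ∑[ i < m ] χ (f i F.≟ w)
      ≤⟨ +-monoʳ-≤ (ℓ ∸ 1) (injective⇒count≤1 f f-injective w) ⟩
    ℓ ∸ 1 + 1
      ≡⟨ m∸n+n≡m ℓ≥1 ⟩
    ℓ ∎
    where
    open ≤-Reasoning
    sources = ∑[ i < m ] χ (lookup (e i) (slot i) F.≟ w)
    helpers : ∑[ u < N ] share μ w (u ↑ˡ m) ≡ ℓ ∸ 1 ∸ crossings w + inflow w
    helpers = begin-equality
      ∑[ u < N ] share μ w (u ↑ˡ m)
        ≡⟨ sum-cong-≗ {N} (λ u → share-assemble-helper helper-split ordinary-split u w) ⟩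
      ∑[ u < N ] (χ (u F.≟ w) * (ℓ ∸ 1 ∸ crossings u) + χ (sucMod u F.≟ w) * crossings u)
        ≡⟨ ∑-distrib-+ {N} (λ u → χ (u F.≟ w) * (ℓ ∸ 1 ∸ crossings u))
                           (λ u → χ (sucMod u F.≟ w) * crossings u) ⟩
      ∑[ u < N ] (χ (u F.≟ w) * (ℓ ∸ 1 ∸ crossings u)) + inflow w
        ≡⟨ cong (_+ inflow w) (sum-select w (λ u → ℓ ∸ 1 ∸ crossings u)) ⟩
      ℓ ∸ 1 ∸ crossings w + inflow w ∎
    ordinaries : ∑[ i < m ] share μ w (N ↑ʳ i) ≡ sources
    ordinaries = sum-cong-≗ {m} λ i → trans (share-assemble-ordinary helper-split ordinary-split i w)
      (trans (sum-cong-≗ {k} λ p → *-comm (χ (lookup (e i) p F.≟ w)) (χ (p F.≟ slot i)))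
             (sum-select (slot i) (λ p → χ (lookup (e i) p F.≟ w))))

  Ŵ-orientable : WOrientable (Ŵ N k ℓ m e)
  Ŵ-orientable = μ , μ-weights , μ-load

arrivals : ∀ {m} → (Fin m → ℕ) → ℕ → ℕ
arrivals {m} P q = ∑[ i < m ] χ (P i ≟ q)

module LinearQueue (N m L : ℕ) (P : Fin m → ℕ) (P<N : ∀ i → P i < N)
  (backlog : ℕ → ℕ) (backlog≤L : ∀ q → backlog q ≤ L)
  (backlog-N-min : ∀ q → backlog N ≤ backlog q)
  (backlog-step : ∀ q → q < N → arrivals P q + backlog q ≤ 1 + backlog (suc q)) where

  arrivals-in : ℕ → ℕ → ℕ
  arrivals-in a l = sumUpTo l (λ r → arrivals P (a + r))

  arrivals-in-suc : ∀ a l → arrivals-in a (suc l) ≡ arrivals P a + arrivals-in (suc a) l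
  arrivals-in-suc a l = cong₂ _+_ (cong (arrivals P) (+-identityʳ a))
                                  (sum-cong-≗ {l} λ r → cong (arrivals P) (+-suc a (toℕ r)))

  telescope : ∀ a l → a + l ≤ N → arrivals-in a l + backlog a ≤ l + backlog (a + l)
  telescope a zero a≤N = ≤-reflexive (cong backlog (sym (+-identityʳ a)))
  telescope a (suc l) a+l<N = begin
    arrivals-in a (suc l) + backlog a
      ≡⟨ cong (_+ backlog a) (arrivals-in-suc a l) ⟩
    arrivals P a + arrivals-in (suc a) l + backlog a
      ≡⟨ xy∙z≈xz∙y (arrivals P a) _ (backlog a) ⟩
    arrivals P a + backlog a + arrivals-in (suc a) l
      ≤⟨ +-monoˡ-≤ _ (backlog-step a (≤-trans (s≤s (m≤m+n a l)) (subst (_≤ N) (+-suc a l) a+l<N))) ⟩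
    1 + backlog (suc a) + arrivals-in (suc a) l
      ≡⟨ xy∙z≈xz∙y 1 (backlog (suc a)) _ ⟩
    1 + arrivals-in (suc a) l + backlog (suc a)
      ≤⟨ +-monoʳ-≤ 1 (telescope (suc a) l (subst (_≤ N) (+-suc a l) a+l<N)) ⟩
    suc (l + backlog (suc a + l))
      ≡⟨ cong (λ x → suc (l + backlog x)) (+-suc a l) ⟨
    suc l + backlog (a + suc l) ∎
    where open ≤-Reasoning

  rank : Fin m → Fin (N * m)
  rank i = F.combine (fromℕ< (P<N i)) i

  _≼_ _≺_ : Fin m → Fin m → Set
  j ≼ i = rank j F.≤ rank i
  j ≺ i = rank j F.< rank i

  _≼?_ : ∀ j i → Dec (j ≼ i)
  j ≼? i = rank j FP.≤? rank i

  _≺?_ : ∀ j i → Dec (j ≺ i)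
  j ≺? i = rank j FP.<? rank i

  ≼⇒P≤ : ∀ {j i} → j ≼ i → P j ≤ P i
  ≼⇒P≤ {j} {i} j≼i = ≮⇒≥ λ Pi<Pj → <⇒≱ (FP.combine-monoˡ-< i j (fromℕ<-mono Pi<Pj)) j≼i
    where
    fromℕ<-mono : P i < P j → fromℕ< (P<N i) F.< fromℕ< (P<N j)
    fromℕ<-mono = subst₂ _<_ (sym (FP.toℕ-fromℕ< (P<N i))) (sym (FP.toℕ-fromℕ< (P<N j)))

  ≺-total : ∀ {i j} → i ≢ j → i ≺ j ⊎ j ≺ i
  ≺-total {i} {j} i≢j with FP.<-cmp (rank i) (rank j)
  ... | tri< i≺j _ _ = inj₁ i≺j
  ... | tri≈ _ same _ =
    ⊥-elim (i≢j (proj₂ (FP.combine-injective (fromℕ< (P<N i)) i (fromℕ< (P<N j)) j same)))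
  ... | tri> _ _ j≺i = inj₂ j≺i

  in-range? : ∀ j i k → Dec (j ≼ k × k ≺ i)
  in-range? j i k = (j ≼? k) ×-dec (k ≺? i)

  between : Fin m → Fin m → ℕ
  between j i = ∑[ k < m ] χ (in-range? j i k)

  candidate : Fin m → Fin m → ℕ
  candidate i j = χ (j ≼? i) * (P j + between j i)

  -- The departure time of item i when items are served first-in-first-out in rank order.
  T : Fin m → ℕ
  T i = max (candidate i)

  in-window : ∀ {a l x} → a ≤ x → x < a + l → 1 ≤ sumUpTo l (λ r → χ (x ≟ a + r))
  in-window {a} {l} {x} a≤x x<a+l = begin
    1                                   ≡⟨ χ-true (x ≟ a + (x ∸ a)) (sym (m+[n∸m]≡n a≤x)) ⟨
    χ (x ≟ a + (x ∸ a))                 ≤⟨ term≤sumUpTo (λ r → χ (x ≟ a + r)) (+-cancelˡ-< a (x ∸ a) l a+[x∸a]<a+l) ⟩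
    sumUpTo l (λ r → χ (x ≟ a + r))     ∎
    where
    open ≤-Reasoning
    a+[x∸a]<a+l : a + (x ∸ a) < a + l
    a+[x∸a]<a+l = subst (_< a + l) (sym (m+[n∸m]≡n a≤x)) x<a+l

  between<arrivals-in : ∀ {j i} a l → j ≼ i → (∀ k → j ≼ k → k ≼ i → a ≤ P k × P k < a + l) →
                        between j i < arrivals-in a l
  between<arrivals-in {j} {i} a l j≼i window = begin-strict
    between j i             <⟨ sum-mono-< counted≤occupancy i i-uncounted ⟩
    ∑[ k < m ] occupancy k  ≡⟨ ∑-comm {m} {l} (λ k r → χ (P k ≟ a + toℕ r)) ⟩
    arrivals-in a l         ∎
    where
    open ≤-Reasoning
    occupancy : Fin m → ℕ
    occupancy k = sumUpTo l (λ r → χ (P k ≟ a + r))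
    occupied : ∀ k → j ≼ k → k ≼ i → 1 ≤ occupancy k
    occupied k j≼k k≼i = let a≤Pk , Pk<a+l = window k j≼k k≼i in in-window a≤Pk Pk<a+l
    counted≤occupancy : ∀ k → χ (in-range? j i k) ≤ occupancy k
    counted≤occupancy k = χ≤ (in-range? j i k) λ (j≼k , k≺i) → occupied k j≼k (<⇒≤ k≺i)
    i-uncounted : χ (in-range? j i i) < occupancy i
    i-uncounted = subst (_< occupancy i) (sym (χ-false (in-range? j i i) λ (_ , i≺i) → FP.<-irrefl refl i≺i))
                        (occupied i j≼i ≤-refl)

  between-bound : ∀ {j i} a l → a + l ≤ N → j ≼ i → (∀ k → j ≼ k → k ≼ i → a ≤ P k × P k < a + l) →
                  between j i + backlog a < l + backlog (a + l)
  between-bound a l a+l≤N j≼i window =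
    <-≤-trans (+-monoˡ-< (backlog a) (between<arrivals-in a l j≼i window)) (telescope a l a+l≤N)

  candidate≤T : ∀ {j i} → j ≼ i → P j + between j i ≤ T i
  candidate≤T {j} {i} j≼i = subst (_≤ T i) (χ*-true (j ≼? i) j≼i) (term≤max (candidate i) j)

  P≤T : ∀ i → P i ≤ T i
  P≤T i = ≤-trans (m≤m+n (P i) (between i i)) (candidate≤T ≤-refl)

  T≤P+L : ∀ i → T i ≤ P i + L
  T≤P+L i = max≤ (candidate i) λ j → χ*-elim (_≤ P i + L) (j ≼? i) (bound j) z≤n
    where
    bound : ∀ j → j ≼ i → P j + between j i ≤ P i + L
    bound j j≼i = begin
      P j + between j i        ≤⟨ +-monoʳ-≤ (P j) (s≤s⁻¹ counted) ⟩
      P j + ((P i ∸ P j) + L)  ≡⟨ +-assoc (P j) _ L ⟨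
      P j + (P i ∸ P j) + L    ≡⟨ cong (_+ L) (m+[n∸m]≡n Pj≤Pi) ⟩
      P i + L                  ∎
      where
      open ≤-Reasoning
      Pj≤Pi = ≼⇒P≤ j≼i
      l = suc (P i ∸ P j)
      ends-after-i : P j + l ≡ suc (P i)
      ends-after-i = trans (+-suc (P j) _) (cong suc (m+[n∸m]≡n Pj≤Pi))
      counted : between j i < l + L
      counted = <-≤-trans (≤-<-trans (m≤m+n _ _)
                  (between-bound (P j) l (subst (_≤ N) (sym ends-after-i) (P<N i)) j≼i
                    (λ k j≼k k≼i → ≼⇒P≤ j≼k , subst (P k <_) (sym ends-after-i) (s≤s (≼⇒P≤ k≼i)))))
                  (+-monoʳ-≤ l (backlog≤L (P j + l)))

  T<N : ∀ i → T i < N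
  T<N i = max< (candidate i) 0<N λ j → χ*-elim (_< N) (j ≼? i) (bound j) 0<N
    where
    0<N = ≤-trans z<s (P<N i)
    bound : ∀ j → j ≼ i → P j + between j i < N
    bound j j≼i = begin-strict
      P j + between j i  <⟨ +-monoʳ-< (P j) counted ⟩
      P j + l            ≡⟨ ends-at-N ⟩
      N                  ∎
      where
      open ≤-Reasoning
      l = N ∸ P j
      ends-at-N : P j + l ≡ N
      ends-at-N = m+[n∸m]≡n (<⇒≤ (P<N j))
      counted : between j i < l
      counted = +-cancelʳ-< (backlog (P j)) _ l (begin-strict
        between j i + backlog (P j)  <⟨ between-bound (P j) l (≤-reflexive ends-at-N) j≼i
                                          (λ k j≼k k≼i → ≼⇒P≤ j≼k , subst (P k <_) (sym ends-at-N) (P<N k)) ⟩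
        l + backlog (P j + l)        ≡⟨ cong (λ x → l + backlog x) ends-at-N ⟩
        l + backlog N                ≤⟨ +-monoʳ-≤ l (backlog-N-min (P j)) ⟩
        l + backlog (P j)            ∎)

  between-mono-< : ∀ {j i i′} → j ≼ i → i ≺ i′ → between j i < between j i′
  between-mono-< {j} {i} {i′} j≼i i≺i′ = sum-mono-< counted-earlier i (begin-strict
      χ (in-range? j i i)   ≡⟨ χ-false (in-range? j i i) (λ (_ , i≺i) → FP.<-irrefl refl i≺i) ⟩
      0                     <⟨ z<s ⟩
      1                     ≡⟨ χ-true (in-range? j i′ i) (j≼i , i≺i′) ⟨
      χ (in-range? j i′ i)  ∎)
    where
    open ≤-Reasoning
    counted-earlier : ∀ k → χ (in-range? j i k) ≤ χ (in-range? j i′ k)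
    counted-earlier k = χ-mono (in-range? j i k) (in-range? j i′ k) λ (j≼k , k≺i) → j≼k , <-trans k≺i i≺i′

  T-mono-< : ∀ {i i′} → i ≺ i′ → T i < T i′
  T-mono-< {i} {i′} i≺i′ = max< (candidate i) 0<Ti′ λ j → χ*-elim (_< T i′) (j ≼? i) (below j) 0<Ti′
    where
    below : ∀ j → j ≼ i → P j + between j i < T i′
    below j j≼i = <-≤-trans (+-monoʳ-< (P j) (between-mono-< j≼i i≺i′)) (candidate≤T (≤-trans j≼i (<⇒≤ i≺i′)))
    0<Ti′ : 0 < T i′
    0<Ti′ = ≤-<-trans z≤n (below i ≤-refl)

  T-injective : ∀ {i i′} → T i ≡ T i′ → i ≡ i′
  T-injective {i} {i′} Ti≡Ti′ with i F.≟ i′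
  ... | yes i≡i′ = i≡i′
  ... | no i≢i′ with ≺-total i≢i′
  ...   | inj₁ i≺i′ = ⊥-elim (<-irrefl Ti≡Ti′ (T-mono-< i≺i′))
  ...   | inj₂ i′≺i = ⊥-elim (<-irrefl (sym Ti≡Ti′) (T-mono-< i′≺i))

module CyclicQueue {n m} (L : ℕ) (s : Fin m → Fin (suc n)) (Y : Fin (suc n) → ℕ) (Y≤L : ∀ u → Y u ≤ L)
  (Y-step : ∀ u → ∑[ i < m ] χ (s i F.≟ sucMod u) + Y u ≤ 1 + Y (sucMod u)) where

  private
    N : ℕ
    N = suc n

  u₀ : Fin N
  u₀ = argmin Y fzero (allFin N)

  u₀-min : ∀ v → Y u₀ ≤ Y v
  u₀-min v = All.lookup (f[argmin]≤f[xs] {f = Y} fzero (allFin N)) (∈-allFin v)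

  c : ℕ
  c = suc (toℕ u₀)

  c≤N : c ≤ N
  c≤N = FP.toℕ<n u₀

  P : Fin m → ℕ
  P i = unrotate c (s i)

  -- Positions are counted from vertex c = u₀ + 1; backlog q is what Y carries into position q.
  backlog : ℕ → ℕ
  backlog q = Y ((toℕ u₀ + q) mod N)

  backlog-N-min : ∀ q → backlog N ≤ backlog q
  backlog-N-min q = subst (λ u → Y u ≤ backlog q) (sym wraps-to-u₀) (u₀-min _)
    where
    wraps-to-u₀ : (toℕ u₀ + N) mod N ≡ u₀
    wraps-to-u₀ = trans (mod-cong {N = N} {toℕ u₀ + N} {toℕ u₀} ([m+n]%n≡m%n (toℕ u₀) N)) (toℕ-mod-id u₀)

  backlog-step : ∀ q → q < N → arrivals P q + backlog q ≤ 1 + backlog (suc q)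
  backlog-step q q<N = subst₂ (λ a b → a + backlog q ≤ 1 + Y b) (sym arrivals≡) (sym next≡) (Y-step u)
    where
    u = (toℕ u₀ + q) mod N
    arrives-at : rotate c q ≡ sucMod u
    arrives-at = sym (sucMod-mod (toℕ u₀ + q))
    next≡ : (toℕ u₀ + suc q) mod N ≡ sucMod u
    next≡ = trans (cong (_mod N) (+-suc (toℕ u₀) q)) arrives-at
    arrivals≡ : arrivals P q ≡ ∑[ i < m ] χ (s i F.≟ sucMod u)
    arrivals≡ = sum-cong-≗ {m} λ i → χ-cong (P i ≟ q) (s i F.≟ sucMod u)
      (λ Pi≡q → trans (sym (rotate-unrotate c≤N (s i))) (trans (cong (rotate c) Pi≡q) arrives-at))
      (λ si≡ → trans (cong (unrotate c) (trans si≡ (sym arrives-at))) (unrotate-rotate c≤N q<N))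

  open LinearQueue N m L P (λ i → m%n<n (toℕ (s i) + (N ∸ c)) N)
                   backlog (λ q → Y≤L _) backlog-N-min backlog-step
    using (T; P≤T; T≤P+L; T<N; T-injective)

  g : Fin m → Fin N
  g i = rotate c (T i)

  g-injective : ∀ {i j} → g i ≡ g j → i ≡ j
  g-injective {i} {j} gi≡gj = T-injective (begin
    T i                     ≡⟨ unrotate-rotate c≤N (T<N i) ⟨
    unrotate c (g i)        ≡⟨ cong (unrotate c) gi≡gj ⟩
    unrotate c (g j)        ≡⟨ unrotate-rotate c≤N (T<N j) ⟩
    T j                     ∎)
    where open ≡-Reasoning

  delay : Fin m → ℕ
  delay i = T i ∸ P i

  delay≤L : ∀ i → delay i ≤ L
  delay≤L i = m≤n+o⇒m∸n≤o (T i) (P i) (T≤P+L i)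

  g≡s+delay : ∀ i → toℕ (g i) ≡ (toℕ (s i) + delay i) % N
  g≡s+delay i = begin
    toℕ (rotate c (T i))                  ≡⟨ toℕ-mod (c + T i) ⟩
    (c + T i) % N                         ≡⟨ cong (λ x → (c + x) % N) (m+[n∸m]≡n (P≤T i)) ⟨
    (c + (P i + delay i)) % N             ≡⟨ cong (_% N) (+-assoc c (P i) (delay i)) ⟨
    (c + P i + delay i) % N               ≡⟨ %-absorbˡ {N = N} (c + P i) (delay i) ⟨
    ((c + P i) % N + delay i) % N         ≡⟨ cong (λ x → (x + delay i) % N) (toℕ-mod {N = N} (c + P i)) ⟨
    (toℕ (rotate {N} c (P i)) + delay i) % N ≡⟨ cong (λ v → (toℕ v + delay i) % N) (rotate-unrotate c≤N (s i)) ⟩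
    (toℕ (s i) + delay i) % N             ∎
    where open ≡-Reasoning

module Ŵ⇒W (n k ℓ m : ℕ) (e : Fin m → Vec (Fin (suc n)) k) (ℓ≥1 : 1 ≤ ℓ)
  (orientation : WOrientable (Ŵ (suc n) k ℓ m e)) where

  private
    N : ℕ
    N = suc n

  open ŴLoad N k ℓ m e
  open WHypergraph (Ŵ N k ℓ m e) using (size; ηE)

  μ : WOrientation (Ŵ N k ℓ m e)
  μ = proj₁ orientation

  μ-weights : ∀ x → sumFin (size x) (μ x) ≡ ηE x
  μ-weights = proj₁ (proj₂ orientation)

  μ-load : ∀ w → load (Ŵ N k ℓ m e) μ w ≤ ℓ
  μ-load = proj₂ (proj₂ orientation)

  slot : Fin m → Fin k
  slot i = proj₁ (ordinary-share μ μ-weights i)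

  s : Fin m → Fin N
  s i = lookup (e i) (slot i)

  X Y : Fin N → ℕ
  X u = proj₁ (helper-share μ μ-weights u)
  Y u = proj₁ (proj₂ (helper-share μ μ-weights u))

  X+Y : ∀ u → X u + Y u ≡ ℓ ∸ 1
  X+Y u = proj₁ (proj₂ (proj₂ (helper-share μ μ-weights u)))

  helper-share≡ : ∀ u w → share μ w (u ↑ˡ m) ≡ χ (u F.≟ w) * X u + χ (sucMod u F.≟ w) * Y u
  helper-share≡ u = proj₂ (proj₂ (proj₂ (helper-share μ μ-weights u)))

  Y≤ : ∀ u → Y u ≤ ℓ ∸ 1
  Y≤ u = subst (Y u ≤_) (X+Y u) (m≤n+m (Y u) (X u))

  helpers-into : ∀ u → X (sucMod u) + Y u ≤ ∑[ v < N ] share μ (sucMod u) (v ↑ˡ m)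
  helpers-into u with u F.≟ sucMod u
  ... | yes u≡w = begin
    X w + Y u                                     ≡⟨ cong (λ v → X w + Y v) u≡w ⟩
    X w + Y w                                     ≡⟨ cong₂ _+_ (χ*-true (w F.≟ w) refl)
                                                               (χ*-true (sucMod w F.≟ w) (cong sucMod (sym u≡w))) ⟨
    χ (w F.≟ w) * X w + χ (sucMod w F.≟ w) * Y w  ≡⟨ helper-share≡ w w ⟨
    share μ w (w ↑ˡ m)                            ≤⟨ term≤sum (λ v → share μ w (v ↑ˡ m)) w ⟩
    ∑[ v < N ] share μ w (v ↑ˡ m)                 ∎
    where
    open ≤-Reasoning
    w = sucMod u
  ... | no u≢w = ≤-trans (+-mono-≤ X-into Y-into) (two-terms≤sum (λ v → share μ w (v ↑ˡ m)) (u≢w ∘ sym))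
    where
    open ≤-Reasoning
    w = sucMod u
    X-into : X w ≤ share μ w (w ↑ˡ m)
    X-into = begin
      X w                                           ≡⟨ χ*-true (w F.≟ w) refl ⟨
      χ (w F.≟ w) * X w                             ≤⟨ m≤m+n _ _ ⟩
      χ (w F.≟ w) * X w + χ (sucMod w F.≟ w) * Y w  ≡⟨ helper-share≡ w w ⟨
      share μ w (w ↑ˡ m)                            ∎
    Y-into : Y u ≤ share μ w (u ↑ˡ m)
    Y-into = begin
      Y u                                           ≡⟨ χ*-true (sucMod u F.≟ w) refl ⟨
      χ (sucMod u F.≟ w) * Y u                      ≤⟨ m≤n+m _ _ ⟩
      χ (u F.≟ w) * X u + χ (sucMod u F.≟ w) * Y u  ≡⟨ helper-share≡ u w ⟨
      share μ w (u ↑ˡ m)                            ∎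

  Y-step : ∀ u → ∑[ i < m ] χ (s i F.≟ sucMod u) + Y u ≤ 1 + Y (sucMod u)
  Y-step u = +-cancelˡ-≤ (X w) _ _ (begin
    X w + (arrivals-w + Y u)   ≡⟨ x∙yz≈xz∙y (X w) arrivals-w (Y u) ⟩
    X w + Y u + arrivals-w     ≤⟨ +-mono-≤ (helpers-into u) (sum-mono-≤ λ i → proj₂ (ordinary-share μ μ-weights i) w) ⟩
    ∑[ v < N ] share μ w (v ↑ˡ m) + ∑[ i < m ] share μ w (N ↑ʳ i)
                               ≡⟨ load-Ŵ μ w ⟨
    load (Ŵ N k ℓ m e) μ w     ≤⟨ μ-load w ⟩
    ℓ                          ≡⟨ m∸n+n≡m ℓ≥1 ⟨
    ℓ ∸ 1 + 1                  ≡⟨ cong (_+ 1) (X+Y w) ⟨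
    X w + Y w + 1              ≡⟨ xy∙z≈x∙zy (X w) (Y w) 1 ⟩
    X w + (1 + Y w)            ∎)
    where
    open ≤-Reasoning
    w = sucMod u
    arrivals-w = ∑[ i < m ] χ (s i F.≟ w)

  open CyclicQueue (ℓ ∸ 1) s Y Y≤ Y-step using (g; g-injective; delay; delay≤L; g≡s+delay)

  W-orientable : Orientable (W N k ℓ m e)
  W-orientable = g , (λ i → slot i , delay i , delay<ℓ i , g≡s+delay i) , g-injective
    where
    delay<ℓ : ∀ i → delay i < ℓ
    delay<ℓ i = ≤-trans (s≤s (delay≤L i)) (≤-reflexive (trans (+-comm 1 (ℓ ∸ 1)) (m∸n+n≡m ℓ≥1)))

proposition1 : (n k ℓ m : ℕ) → 2 ≤ k → 2 ≤ ℓ → (e : Fin m → Vec (Fin n) k) →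
    WOrientable (Ŵ n k ℓ m e) ⇔ Orientable (W n k ℓ m e)
proposition1 zero (suc k) ℓ m _ _ e = mk⇔
  (λ _ → (λ i → lookup (e i) fzero) , ⊥-elim ∘ no-edge , λ {i} {_} _ → ⊥-elim (no-edge i))
  (λ _ → (λ x → ⊥-elim (no-edge x)) , ⊥-elim ∘ no-edge , ⊥-elim ∘ FP.¬Fin0)
  where
  no-edge : Fin m → ⊥
  no-edge i = FP.¬Fin0 (lookup (e i) fzero)
proposition1 (suc n) k ℓ m _ 2≤ℓ e =
  mk⇔ (Ŵ⇒W.W-orientable n k ℓ m e 1≤ℓ) (W⇒Ŵ.Ŵ-orientable n k ℓ m e 1≤ℓ)
  where
  1≤ℓ : 1 ≤ ℓ
  1≤ℓ = ≤-trans (s≤s z≤n) 2≤ℓ
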